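{- Let $f\in\mathbb{F}\langle X\rangle$ be a non-zero non-commutative polynomial of degree $D$ over $X=\{x_1,\ldots,x_n\}$, and let $\mathrm{K}\in\mathbb{N}$. Set $n_1=n$ and $Z_1=X$ (so $z_{1,j}=x_j$), and for each $2\le i\le \mathrm{K}+1$ let $Z_i=\{z_{i1},\ldots,z_{in_i}\}$ be a set of non-commuting variables, $n_i\in\mathbb{N}$. For each $1\le i\le \mathrm{K}$ let $A_i=(A_{i1},\ldots,A_{in_i})$ be matrices of dimension $d_i$ with $A_{ij}\in\mathbb{F}^{d_i\times d_i}\langle Z_{i+1}\rangle$ of the form $A_{ij}=\sum_{k=1}^{n_{i+1}}A^{(k)}_{ij}z_{i+1,k}$ with $A^{(k)}_{ij}\in\mathbb{F}^{d_i\times d_i}$. Define $f_0=f$ and, for $i\ge1$, let $f_i\in\mathbb{F}\langle Z_{i+1}\rangle$ be the $[1,d_i]$-th entry of the matrix $f_{i-1}(A_{i1},\ldots,A_{in_i})$ (obtained by substituting $A_{ij}$ for $z_{i,j}$). Then there exists a matrix substitution $C=(C_1,\ldots,C_n)$, each $C_j$ being a square matrix of dimension $\prod_{i\in[\mathrm{K}]}d_i$ with entries in $\mathbb{F}\langle Z_{\mathrm{K}+1}\rangle$, such that $f_{\mathrm{K}}$ equals the $\left[1,\prod_{i\in[\mathrm{K}]}d_i\right]$-th entry of the matrix $f(C_1,\ldots,C_n)$.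
   Context: $\mathbb{F}\langle Z\rangle$ denotes the ring of non-commutative polynomials over $\mathbb{F}$ in the variables $Z$; $\mathbb{F}^{d\times d}\langle Z\rangle$ denotes $d\times d$ matrices with entries in it, and a polynomial is evaluated on such matrices via ordinary matrix addition and multiplication. The $[a,b]$-th entry of a matrix is the entry in row $a$ and column $b$. -}

module Defs where

open import Level using (Level; _⊔_)
open import Algebra.Bundles using (CommutativeRing)
open import Data.Nat using (ℕ; zero; suc; _*_; _<_; _≤_; _>_; z≤n; s≤s)
open import Data.Nat.Properties using (<⇒≤; ≤-refl; m≤n*m)
open import Data.Fin using (Fin; fromℕ<)
open import Data.Fin.Properties using () renaming (_≟_ to _≟ᶠ_)
open import Data.List using (List; []; _∷_; _++_; map; concatMap; foldr; length)
open import Data.List.Properties using (≡-dec)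
open import Data.Product using (_×_; _,_; ∃; Σ)
open import Relation.Nullary using (¬_; yes; no)
open import Relation.Binary.PropositionalEquality using (_≡_)

record Field (c ℓ : Level) : Set (Level.suc (c ⊔ ℓ)) where
  field
    commutativeRing : CommutativeRing c ℓ
  open CommutativeRing commutativeRing using (Carrier; _≈_; 0#; 1#) renaming (_*_ to _·_)
  field
    1≉0     : ¬ (1# ≈ 0#)
    inverse : ∀ x → ¬ (x ≈ 0#) → ∃ λ y → (x · y) ≈ 1#

-- Index helpers: the first and last index of a non-empty range (the "1" and
-- "N" of an N×N matrix, 0-based in Agda).
firstIdx : ∀ {N} → 0 < N → Fin N
firstIdx p = fromℕ< p

lastIdx : ∀ {N} → 0 < N → Fin N
lastIdx {suc N} _ = fromℕ< ≤-refl

prodUpTo : (ℕ → ℕ) → ℕ → ℕ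
prodUpTo d zero    = 1
prodUpTo d (suc K) = prodUpTo d K * d K

prodUpTo-pos : (d : ℕ → ℕ) (K : ℕ) → (∀ i → i < K → 0 < d i) → 0 < prodUpTo d K
prodUpTo-pos d zero    h = s≤s z≤n
prodUpTo-pos d (suc K) h with d K | h K ≤-refl | prodUpTo-pos d K (λ i p → h i (<⇒≤-suc p))
  where
    <⇒≤-suc : ∀ {i K} → i < K → i < suc K
    <⇒≤-suc p = s≤s (<⇒≤ p)
... | suc e | _ | q with prodUpTo d K
...   | suc r = s≤s z≤n

module NCPoly {c ℓ} (F : Field c ℓ) where
  open CommutativeRing (Field.commutativeRing F) using (Carrier; _≈_; 0#; 1#) renaming (_*_ to _·_; _+_ to _⊕_)

  Scalar : Set c
  Scalar = Carrier

  Word : ℕ → Set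
  Word m = List (Fin m)

  -- a polynomial is a finite formal sum of (coefficient, monomial) terms
  Poly : ℕ → Set c
  Poly m = List (Carrier × Word m)

  coeff : ∀ {m} → Poly m → Word m → Carrier
  coeff []             w = 0#
  coeff ((a , u) ∷ p)  w with ≡-dec _≟ᶠ_ u w
  ... | yes _ = a ⊕ coeff p w
  ... | no  _ = coeff p w

  infix 4 _≈ₚ_
  _≈ₚ_ : ∀ {m} → Poly m → Poly m → Set ℓ
  p ≈ₚ q = ∀ w → coeff p w ≈ coeff q w

  0ₚ : ∀ {m} → Poly m
  0ₚ = []

  1ₚ : ∀ {m} → Poly m
  1ₚ = (1# , []) ∷ []

  var : ∀ {m} → Fin m → Poly m
  var k = (1# , k ∷ []) ∷ []

  _+ₚ_ : ∀ {m} → Poly m → Poly m → Poly m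
  p +ₚ q = p ++ q

  _*ₚ_ : ∀ {m} → Poly m → Poly m → Poly m
  p *ₚ q = concatMap (λ { (a , u) → map (λ { (b , v) → (a · b , u ++ v) }) q }) p

  _•ₚ_ : ∀ {m} → Carrier → Poly m → Poly m
  a •ₚ p = map (λ { (b , v) → (a · b , v) }) p

  NonZero : ∀ {m} → Poly m → Set ℓ
  NonZero f = ¬ (f ≈ₚ 0ₚ)

  HasDegree : ∀ {m} → Poly m → ℕ → Set ℓ
  HasDegree f D = (∀ w → length w > D → coeff f w ≈ 0#)
                × (Σ (Word _) λ w → length w ≡ D × ¬ (coeff f w ≈ 0#))

  Mat : ∀ {a} → ℕ → Set a → Set a
  Mat N R = Fin N → Fin N → R

  sumFin : ∀ {m} N → (Fin N → Poly m) → Poly m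
  sumFin zero    g = 0ₚ
  sumFin (suc N) g = g Fin.zero +ₚ sumFin N (λ i → g (Fin.suc i))
    where import Data.Fin as Fin

  _+ᴹ_ : ∀ {m N} → Mat N (Poly m) → Mat N (Poly m) → Mat N (Poly m)
  (M +ᴹ M') a b = M a b +ₚ M' a b

  _*ᴹ_ : ∀ {m N} → Mat N (Poly m) → Mat N (Poly m) → Mat N (Poly m)
  _*ᴹ_ {N = N} M M' a b = sumFin N (λ k → M a k *ₚ M' k b)

  _•ᴹ_ : ∀ {m N} → Carrier → Mat N (Poly m) → Mat N (Poly m)
  (s •ᴹ M) a b = s •ₚ M a b

  0ᴹ : ∀ {m N} → Mat N (Poly m)
  0ᴹ a b = 0ₚ

  1ᴹ : ∀ {m N} → Mat N (Poly m)
  1ᴹ a b with a ≟ᶠ b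
  ... | yes _ = 1ₚ
  ... | no  _ = 0ₚ

  _·z_ : ∀ {m N} → Mat N Carrier → Fin m → Mat N (Poly m)
  (M ·z k) a b = M a b •ₚ var k

  evalMon : ∀ {n m N} → Word n → (Fin n → Mat N (Poly m)) → Mat N (Poly m)
  evalMon []      M = 1ᴹ
  evalMon (j ∷ w) M = M j *ᴹ evalMon w M

  eval : ∀ {n m N} → Poly n → (Fin n → Mat N (Poly m)) → Mat N (Poly m)
  eval []            M = 0ᴹ
  eval ((a , w) ∷ p) M = (a •ᴹ evalMon w M) +ᴹ eval p M

  corner : ∀ {a} {R : Set a} {N} → 0 < N → Mat N R → R
  corner p M = M (firstIdx p) (lastIdx p)

  -- The tower of substitutions (0-based: layer i has nv i variables, nv 0 = n).
  -- Acoef i j k is the constant matrix A^{(k)}_{(i+1)(j+1)} of the paper, so that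
  -- A i j = Σ_k Acoef i j k · z_{i+1,k} has dimension d i.
  module Tower (K : ℕ) (nv : ℕ → ℕ) (d : ℕ → ℕ)
               (dpos : ∀ i → i < K → 0 < d i)
               (Acoef : (i : ℕ) → Fin (nv i) → Fin (nv (suc i)) → Mat (d i) Carrier)
               (f : Poly (nv 0)) where

    Amat : (i : ℕ) → Fin (nv i) → Mat (d i) (Poly (nv (suc i)))
    Amat i j = foldr _+ᴹ_ 0ᴹ (map (λ k → Acoef i j k ·z k) (Data.List.allFin (nv (suc i))))
      where import Data.List

    fs : (i : ℕ) → i ≤ K → Poly (nv i)
    fs zero    _ = f
    fs (suc i) p = corner (dpos i p) (eval (fs i (<⇒≤ p)) (Amat i))

{-# OPTIONS --safe #-}
-- Let C⁽⁰⁾ be the 1 × 1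
-- matrices of the variables x_j, and obtain C⁽ⁱ⁾_j from C⁽ⁱ⁻¹⁾_j by evaluating
-- every entry at A_i, read as a block matrix, so C⁽ⁱ⁾_j has dimension d_1 ⋯ d_i.
-- Evaluation at matrices is a semiring homomorphism, hence the ((a,x),(b,y))
-- entry of f(C⁽ⁱ⁾) is the (x,y) entry of the (a,b) entry of f(C⁽ⁱ⁻¹⁾) evaluated
-- at A_i.  The [1, d_1 ⋯ d_i] entry of a block matrix is the [1, d_i] entry of
-- its [1, d_1 ⋯ d_(i-1)] block, so by induction f_i is the corner entry of
-- f(C⁽ⁱ⁾), and C = C⁽ᴷ⁾ is the substitution sought.
module Submission where

open import Defs
open import Level using (_⊔_)
open import Algebra.Bundles using (CommutativeRing; Semiring)
import Algebra.Properties.Semiring.Sum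
open import Data.Empty using (⊥-elim)
open import Data.Fin using (Fin; zero; suc; toℕ; punchIn; combine; quotient; remainder; _↑ˡ_; _↑ʳ_)
open import Data.Fin.Properties
  using (punchInᵢ≢i; toℕ-injective; toℕ-fromℕ<; toℕ-combine; remQuot-combine;
         combine-injectiveˡ; combine-injectiveʳ)
  renaming (_≟_ to _≟ᶠ_)
open import Data.List using ([]; _∷_; _++_; map)
open import Data.List.Properties using (≡-dec; ++-assoc; ++-identityʳ; map-++)
open import Data.Nat using (ℕ; zero; suc; _+_; _*_; _<_; _≤_; z≤n; s≤s)
import Data.Nat.Properties as ℕ
open import Data.Nat.Properties using (≤-refl)
open import Data.Product using (Σ; _×_; _,_; proj₁; proj₂)
open import Function using (_∘_)
open import Relation.Binary.Bundles using (Setoid)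
open import Relation.Binary.Structures using (IsEquivalence)
import Relation.Binary.Reasoning.Setoid
open import Relation.Binary.PropositionalEquality as ≡ using (_≡_)
open import Relation.Nullary using (¬_; yes; no)

module PolynomialSemiring {c ℓ} (F : Field c ℓ) where
  open NCPoly F
  open CommutativeRing (Field.commutativeRing F)
    renaming (_+_ to _⊕_; _*_ to _·_)
  open import Algebra.Properties.CommutativeSemigroup +-commutativeSemigroup
    using (interchange)
  open import Algebra.Properties.CommutativeSemigroup *-commutativeSemigroup
    using (x∙yz≈y∙xz)
  open import Relation.Binary.Reasoning.Setoid setoid

  -- (a , u) *ₜ_ is definitionally the function that _*ₚ_ maps over its right
  -- factor for the term (a , u).
  _*ₜ_ : ∀ {m} → Scalar × Word m → Scalar × Word m → Scalar × Word m
  (a , u) *ₜ (b , v) = (a · b , u ++ v)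

  linExt : ∀ {m} → (Word m → Scalar) → Poly m → Scalar
  linExt L []            = 0#
  linExt L ((a , u) ∷ p) = a · L u ⊕ linExt L p

  module _ {m} (L : Word m → Scalar) where

    linExt-++ : ∀ p q → linExt L (p ++ q) ≈ linExt L p ⊕ linExt L q
    linExt-++ []            q = sym (+-identityˡ _)
    linExt-++ ((a , u) ∷ p) q = trans (+-congˡ (linExt-++ p q)) (sym (+-assoc _ _ _))

    linExt-• : ∀ s p → linExt L (s •ₚ p) ≈ s · linExt L p
    linExt-• s []            = sym (zeroʳ s)
    linExt-• s ((a , u) ∷ p) =
      trans (+-cong (*-assoc s a (L u)) (linExt-• s p)) (sym (distribˡ s _ _))

    linExt-*ₚ : ∀ p q → linExt L (p *ₚ q) ≈ linExt (λ u → linExt (λ v → L (u ++ v)) q) p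
    linExt-*ₚ []            q = refl
    linExt-*ₚ ((a , u) ∷ p) q =
      trans (linExt-++ (map ((a , u) *ₜ_) q) (p *ₚ q)) (+-cong (linExt-*ₜ q) (linExt-*ₚ p q))
      where
        linExt-*ₜ : ∀ q → linExt L (map ((a , u) *ₜ_) q)
                          ≈ a · linExt (λ v → L (u ++ v)) q
        linExt-*ₜ []            = sym (zeroʳ a)
        linExt-*ₜ ((b , v) ∷ q) =
          trans (+-cong (*-assoc a b _) (linExt-*ₜ q)) (sym (distribˡ a _ _))

  linExt-cong : ∀ {m} {L L′ : Word m → Scalar} p → (∀ u → L u ≈ L′ u) →
                linExt L p ≈ linExt L′ p
  linExt-cong []            L≈L′ = refl
  linExt-cong ((a , u) ∷ p) L≈L′ = +-cong (*-congˡ (L≈L′ u)) (linExt-cong p L≈L′)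

  linExt-⊕ : ∀ {m} (L L′ : Word m → Scalar) p →
             linExt (λ u → L u ⊕ L′ u) p ≈ linExt L p ⊕ linExt L′ p
  linExt-⊕ L L′ []            = sym (+-identityˡ 0#)
  linExt-⊕ L L′ ((a , u) ∷ p) =
    trans (+-cong (distribˡ a _ _) (linExt-⊕ L L′ p)) (interchange _ _ _ _)

  linExt-· : ∀ {m} s (L : Word m → Scalar) p → linExt (λ u → s · L u) p ≈ s · linExt L p
  linExt-· s L []            = sym (zeroʳ s)
  linExt-· s L ((a , u) ∷ p) =
    trans (+-cong (x∙yz≈y∙xz a s (L u)) (linExt-· s L p)) (sym (distribˡ s _ _))

  linExt-0 : ∀ {m} (p : Poly m) → linExt (λ _ → 0#) p ≈ 0#
  linExt-0 []            = refl
  linExt-0 ((a , u) ∷ p) = trans (+-cong (zeroʳ a) (linExt-0 p)) (+-identityˡ 0#)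

  -- Agreement under every linear functional on words.  It implies equality of
  -- coefficients (≋⇒≈ₚ), the only direction the theorem needs, and it turns each
  -- semiring law below into a short computation with linExt.
  infix 4 _≋_
  record _≋_ {m} (p q : Poly m) : Set (c ⊔ ℓ) where
    constructor by-linExt
    field linExt-≈ : ∀ L → linExt L p ≈ linExt L q
  open _≋_ public

  ≋-isEquivalence : ∀ {m} → IsEquivalence (_≋_ {m})
  ≋-isEquivalence = record
    { refl  = by-linExt λ L → refl
    ; sym   = λ p≋q → by-linExt λ L → sym (linExt-≈ p≋q L)
    ; trans = λ p≋q q≋r → by-linExt λ L → trans (linExt-≈ p≋q L) (linExt-≈ q≋r L)
    }

  ≋-setoid : ℕ → Setoid c (c ⊔ ℓ)
  ≋-setoid m = record { isEquivalence = ≋-isEquivalence {m} }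

  module ≋-Reasoning {m} = Relation.Binary.Reasoning.Setoid (≋-setoid m)

  open module ≋-Eq {m} = IsEquivalence (≋-isEquivalence {m}) public
    using () renaming (refl to ≋-refl; sym to ≋-sym; trans to ≋-trans; reflexive to ≋-reflexive)

  δ : ∀ {m} → Word m → Word m → Scalar
  δ w u with ≡-dec _≟ᶠ_ u w
  ... | yes _ = 1#
  ... | no  _ = 0#

  coeff≈linExt-δ : ∀ {m} (p : Poly m) w → coeff p w ≈ linExt (δ w) p
  coeff≈linExt-δ []            w = refl
  coeff≈linExt-δ ((a , u) ∷ p) w with ≡-dec _≟ᶠ_ u w
  ... | yes _ = +-cong (sym (*-identityʳ a)) (coeff≈linExt-δ p w)
  ... | no  _ = trans (coeff≈linExt-δ p w) (sym (trans (+-congʳ (zeroʳ a)) (+-identityˡ _)))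

  ≋⇒≈ₚ : ∀ {m} {p q : Poly m} → p ≋ q → p ≈ₚ q
  ≋⇒≈ₚ {p = p} {q} p≋q w =
    trans (coeff≈linExt-δ p w) (trans (linExt-≈ p≋q (δ w)) (sym (coeff≈linExt-δ q w)))

  module _ {m : ℕ} where

    +ₚ-cong : {p p′ q q′ : Poly m} → p ≋ p′ → q ≋ q′ → p +ₚ q ≋ p′ +ₚ q′
    +ₚ-cong {p} {p′} {q} {q′} p≋p′ q≋q′ = by-linExt λ L → begin
      linExt L (p ++ q)              ≈⟨ linExt-++ L p q ⟩
      linExt L p ⊕ linExt L q        ≈⟨ +-cong (linExt-≈ p≋p′ L) (linExt-≈ q≋q′ L) ⟩
      linExt L p′ ⊕ linExt L q′      ≈⟨ linExt-++ L p′ q′ ⟨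
      linExt L (p′ ++ q′)            ∎

    +ₚ-comm : (p q : Poly m) → p +ₚ q ≋ q +ₚ p
    +ₚ-comm p q = by-linExt λ L →
      trans (linExt-++ L p q) (trans (+-comm _ _) (sym (linExt-++ L q p)))

    *ₚ-cong : {p p′ q q′ : Poly m} → p ≋ p′ → q ≋ q′ → p *ₚ q ≋ p′ *ₚ q′
    *ₚ-cong {p} {p′} {q} {q′} p≋p′ q≋q′ = by-linExt λ L → begin
      linExt L (p *ₚ q)                               ≈⟨ linExt-*ₚ L p q ⟩
      linExt (λ u → linExt (λ v → L (u ++ v)) q) p    ≈⟨ linExt-cong p (λ u → linExt-≈ q≋q′ _) ⟩
      linExt (λ u → linExt (λ v → L (u ++ v)) q′) p   ≈⟨ linExt-≈ p≋p′ _ ⟩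
      linExt (λ u → linExt (λ v → L (u ++ v)) q′) p′  ≈⟨ linExt-*ₚ L p′ q′ ⟨
      linExt L (p′ *ₚ q′)                             ∎

    *ₚ-assoc : (p q r : Poly m) → (p *ₚ q) *ₚ r ≋ p *ₚ (q *ₚ r)
    *ₚ-assoc p q r = by-linExt λ L → begin
      linExt L ((p *ₚ q) *ₚ r)
        ≈⟨ linExt-*ₚ L (p *ₚ q) r ⟩
      linExt (λ t → linExt (λ x → L (t ++ x)) r) (p *ₚ q)
        ≈⟨ linExt-*ₚ _ p q ⟩
      linExt (λ u → linExt (λ v → linExt (λ x → L ((u ++ v) ++ x)) r) q) p
        ≈⟨ linExt-cong p (λ u → linExt-cong q (λ v → linExt-cong r (λ x →
             reflexive (≡.cong L (++-assoc u v x))))) ⟩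
      linExt (λ u → linExt (λ v → linExt (λ x → L (u ++ (v ++ x))) r) q) p
        ≈⟨ linExt-cong p (λ u → linExt-*ₚ (λ t → L (u ++ t)) q r) ⟨
      linExt (λ u → linExt (λ t → L (u ++ t)) (q *ₚ r)) p
        ≈⟨ linExt-*ₚ L p (q *ₚ r) ⟨
      linExt L (p *ₚ (q *ₚ r))
        ∎

    *ₚ-identityˡ : (p : Poly m) → 1ₚ *ₚ p ≋ p
    *ₚ-identityˡ p = by-linExt λ L →
      trans (linExt-*ₚ L 1ₚ p) (trans (+-identityʳ _) (*-identityˡ _))

    *ₚ-identityʳ : (p : Poly m) → p *ₚ 1ₚ ≋ p
    *ₚ-identityʳ p = by-linExt λ L → trans (linExt-*ₚ L p 1ₚ) (linExt-cong p (λ u →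
      trans (+-identityʳ _) (trans (*-identityˡ _) (reflexive (≡.cong L (++-identityʳ u))))))

    *ₚ-zeroʳ : (p : Poly m) → p *ₚ 0ₚ ≋ 0ₚ
    *ₚ-zeroʳ p = by-linExt λ L → trans (linExt-*ₚ L p 0ₚ) (linExt-0 p)

    *ₚ-distribˡ : (p q r : Poly m) → p *ₚ (q +ₚ r) ≋ (p *ₚ q) +ₚ (p *ₚ r)
    *ₚ-distribˡ p q r = by-linExt λ L → begin
      linExt L (p *ₚ (q ++ r))
        ≈⟨ linExt-*ₚ L p (q ++ r) ⟩
      linExt (λ u → linExt (λ v → L (u ++ v)) (q ++ r)) p
        ≈⟨ linExt-cong p (λ u → linExt-++ _ q r) ⟩
      linExt (λ u → linExt (λ v → L (u ++ v)) q ⊕ linExt (λ v → L (u ++ v)) r) p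
        ≈⟨ linExt-⊕ _ _ p ⟩
      linExt (λ u → linExt (λ v → L (u ++ v)) q) p
        ⊕ linExt (λ u → linExt (λ v → L (u ++ v)) r) p
        ≈⟨ +-cong (linExt-*ₚ L p q) (linExt-*ₚ L p r) ⟨
      linExt L (p *ₚ q) ⊕ linExt L (p *ₚ r)
        ≈⟨ linExt-++ L (p *ₚ q) (p *ₚ r) ⟨
      linExt L (p *ₚ q ++ p *ₚ r)
        ∎

    *ₚ-distribʳ : (p q r : Poly m) → (q +ₚ r) *ₚ p ≋ (q *ₚ p) +ₚ (r *ₚ p)
    *ₚ-distribʳ p q r = by-linExt λ L → begin
      linExt L ((q ++ r) *ₚ p)                   ≈⟨ linExt-*ₚ L (q ++ r) p ⟩
      linExt _ (q ++ r)                          ≈⟨ linExt-++ _ q r ⟩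
      linExt _ q ⊕ linExt _ r                    ≈⟨ +-cong (linExt-*ₚ L q p) (linExt-*ₚ L r p) ⟨
      linExt L (q *ₚ p) ⊕ linExt L (r *ₚ p)      ≈⟨ linExt-++ L (q *ₚ p) (r *ₚ p) ⟨
      linExt L (q *ₚ p ++ r *ₚ p)                ∎

  polySemiring : ℕ → Semiring c (c ⊔ ℓ)
  polySemiring m = record
    { Carrier    = Poly m
    ; _≈_        = _≋_
    ; _+_        = _+ₚ_
    ; _*_        = _*ₚ_
    ; 0#         = 0ₚ
    ; 1#         = 1ₚ
    ; isSemiring = record
      { isSemiringWithoutAnnihilatingZero = record
        { +-isCommutativeMonoid = record
          { isMonoid = record
            { isSemigroup = record
              { isMagma = record { isEquivalence = ≋-isEquivalence ; ∙-cong = +ₚ-cong }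
              ; assoc   = λ p q r → ≋-reflexive (++-assoc p q r)
              }
            ; identity = (λ p → ≋-reflexive ≡.refl) , (λ p → ≋-reflexive (++-identityʳ p))
            }
          ; comm = +ₚ-comm
          }
        ; *-cong     = *ₚ-cong
        ; *-assoc    = *ₚ-assoc
        ; *-identity = *ₚ-identityˡ , *ₚ-identityʳ
        ; distrib    = *ₚ-distribˡ , *ₚ-distribʳ
        }
      ; zero = (λ p → ≋-reflexive ≡.refl) , *ₚ-zeroʳ
      }
    }

  module _ {m : ℕ} where

    •ₚ-cong : ∀ s {p q : Poly m} → p ≋ q → s •ₚ p ≋ s •ₚ q
    •ₚ-cong s {p} {q} p≋q = by-linExt λ L →
      trans (linExt-• L s p) (trans (*-congˡ (linExt-≈ p≋q L)) (sym (linExt-• L s q)))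

    •ₚ-assoc : ∀ s t (p : Poly m) → (s · t) •ₚ p ≋ s •ₚ (t •ₚ p)
    •ₚ-assoc s t p = by-linExt λ L → begin
      linExt L ((s · t) •ₚ p)       ≈⟨ linExt-• L (s · t) p ⟩
      (s · t) · linExt L p          ≈⟨ *-assoc s t _ ⟩
      s · (t · linExt L p)          ≈⟨ *-congˡ (linExt-• L t p) ⟨
      s · linExt L (t •ₚ p)         ≈⟨ linExt-• L s (t •ₚ p) ⟨
      linExt L (s •ₚ (t •ₚ p))      ∎

    •ₚ-identityˡ : (p : Poly m) → 1# •ₚ p ≋ p
    •ₚ-identityˡ p = by-linExt λ L → trans (linExt-• L 1# p) (*-identityˡ _)

    •ₚ-distrib-+ₚ : ∀ s (p q : Poly m) → s •ₚ (p +ₚ q) ≡ (s •ₚ p) +ₚ (s •ₚ q)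
    •ₚ-distrib-+ₚ s p q = map-++ _ p q

    •ₚ-*ₚ : ∀ s (p q : Poly m) → (s •ₚ p) *ₚ q ≋ s •ₚ (p *ₚ q)
    •ₚ-*ₚ s p q = by-linExt λ L → begin
      linExt L ((s •ₚ p) *ₚ q)                            ≈⟨ linExt-*ₚ L (s •ₚ p) q ⟩
      linExt (λ u → linExt (λ v → L (u ++ v)) q) (s •ₚ p)  ≈⟨ linExt-• _ s p ⟩
      s · linExt (λ u → linExt (λ v → L (u ++ v)) q) p     ≈⟨ *-congˡ (linExt-*ₚ L p q) ⟨
      s · linExt L (p *ₚ q)                               ≈⟨ linExt-• L s (p *ₚ q) ⟨
      linExt L (s •ₚ (p *ₚ q))                            ∎

    *ₚ-•ₚ : ∀ s (p q : Poly m) → p *ₚ (s •ₚ q) ≋ s •ₚ (p *ₚ q)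
    *ₚ-•ₚ s p q = by-linExt λ L → begin
      linExt L (p *ₚ (s •ₚ q))
        ≈⟨ linExt-*ₚ L p (s •ₚ q) ⟩
      linExt (λ u → linExt (λ v → L (u ++ v)) (s •ₚ q)) p
        ≈⟨ linExt-cong p (λ u → linExt-• _ s q) ⟩
      linExt (λ u → s · linExt (λ v → L (u ++ v)) q) p
        ≈⟨ linExt-· s _ p ⟩
      s · linExt (λ u → linExt (λ v → L (u ++ v)) q) p
        ≈⟨ *-congˡ (linExt-*ₚ L p q) ⟨
      s · linExt L (p *ₚ q)
        ≈⟨ linExt-• L s (p *ₚ q) ⟨
      linExt L (s •ₚ (p *ₚ q))
        ∎

module MatrixAlgebra {c ℓ} (F : Field c ℓ) where
  open NCPoly F
  open PolynomialSemiring F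
  open module PolySum {m} = Algebra.Properties.Semiring.Sum (polySemiring m)
    using (sum; sum-syntax; sum-cong-≋; ∑-comm; ∑-distrib-+; *-distribˡ-sum; *-distribʳ-sum;
           sum-remove; sum-replicate-zero)
  open ≋-Reasoning

  infix 4 _≋ᴹ_
  _≋ᴹ_ : ∀ {m N} → Mat N (Poly m) → Mat N (Poly m) → Set (c ⊔ ℓ)
  X ≋ᴹ Y = ∀ a b → X a b ≋ Y a b

  sumFin≡sum : ∀ {m} N (g : Fin N → Poly m) → sumFin N g ≡ sum g
  sumFin≡sum zero    g = ≡.refl
  sumFin≡sum (suc N) g = ≡.cong (g zero ++_) (sumFin≡sum N (λ i → g (suc i)))

  sumFin-cong : ∀ {m} N {g h : Fin N → Poly m} → (∀ k → g k ≋ h k) → sumFin N g ≋ sumFin N h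
  sumFin-cong N {g} {h} g≋h = ≋-trans (≋-reflexive (sumFin≡sum N g))
    (≋-trans (sum-cong-≋ g≋h) (≋-reflexive (≡.sym (sumFin≡sum N h))))

  •ₚ-distrib-sum : ∀ {m N} s (g : Fin N → Poly m) → s •ₚ sum g ≡ ∑[ k < N ] (s •ₚ g k)
  •ₚ-distrib-sum {N = zero}  s g = ≡.refl
  •ₚ-distrib-sum {N = suc N} s g = ≡.trans (•ₚ-distrib-+ₚ s (g zero) (sum (λ k → g (suc k))))
    (≡.cong ((s •ₚ g zero) ++_) (•ₚ-distrib-sum s (λ k → g (suc k))))

  1ᴹ-diag : ∀ {m N} (a : Fin N) → 1ᴹ {m} a a ≡ 1ₚ
  1ᴹ-diag a with a ≟ᶠ a
  ... | yes _   = ≡.refl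
  ... | no  a≢a = ⊥-elim (a≢a ≡.refl)

  1ᴹ-offDiag : ∀ {m N} {a b : Fin N} → ¬ a ≡ b → 1ᴹ {m} a b ≡ 0ₚ
  1ᴹ-offDiag {a = a} {b} a≢b with a ≟ᶠ b
  ... | yes a≡b = ⊥-elim (a≢b a≡b)
  ... | no  _   = ≡.refl

  module _ {m N : ℕ} where

    *ᴹ-entry : (X Y : Mat N (Poly m)) → ∀ a b → (X *ᴹ Y) a b ≋ ∑[ k < N ] (X a k *ₚ Y k b)
    *ᴹ-entry X Y a b = ≋-reflexive (sumFin≡sum N _)

    *ᴹ-cong : {X X′ Y Y′ : Mat N (Poly m)} → X ≋ᴹ X′ → Y ≋ᴹ Y′ → X *ᴹ Y ≋ᴹ X′ *ᴹ Y′
    *ᴹ-cong X≋X′ Y≋Y′ a b = sumFin-cong N (λ k → *ₚ-cong (X≋X′ a k) (Y≋Y′ k b))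

    *ᴹ-assoc : (X Y Z : Mat N (Poly m)) → (X *ᴹ Y) *ᴹ Z ≋ᴹ X *ᴹ (Y *ᴹ Z)
    *ᴹ-assoc X Y Z a b = begin
      ((X *ᴹ Y) *ᴹ Z) a b
        ≈⟨ *ᴹ-entry (X *ᴹ Y) Z a b ⟩
      ∑[ l < N ] ((X *ᴹ Y) a l *ₚ Z l b)
        ≈⟨ sum-cong-≋ (λ l → *ₚ-cong (*ᴹ-entry X Y a l) (≋-refl {x = Z l b})) ⟩
      ∑[ l < N ] ((∑[ k < N ] (X a k *ₚ Y k l)) *ₚ Z l b)
        ≈⟨ sum-cong-≋ (λ l → *-distribʳ-sum (Z l b) (λ k → X a k *ₚ Y k l)) ⟩
      ∑[ l < N ] ∑[ k < N ] ((X a k *ₚ Y k l) *ₚ Z l b)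
        ≈⟨ ∑-comm (λ l k → (X a k *ₚ Y k l) *ₚ Z l b) ⟩
      ∑[ k < N ] ∑[ l < N ] ((X a k *ₚ Y k l) *ₚ Z l b)
        ≈⟨ sum-cong-≋ (λ k → sum-cong-≋ (λ l → *ₚ-assoc (X a k) (Y k l) (Z l b))) ⟩
      ∑[ k < N ] ∑[ l < N ] (X a k *ₚ (Y k l *ₚ Z l b))
        ≈⟨ sum-cong-≋ (λ k → *-distribˡ-sum (X a k) (λ l → Y k l *ₚ Z l b)) ⟨
      ∑[ k < N ] (X a k *ₚ (∑[ l < N ] (Y k l *ₚ Z l b)))
        ≈⟨ sum-cong-≋ (λ k → *ₚ-cong (≋-refl {x = X a k}) (*ᴹ-entry Y Z k b)) ⟨
      ∑[ k < N ] (X a k *ₚ (Y *ᴹ Z) k b)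
        ≈⟨ *ᴹ-entry X (Y *ᴹ Z) a b ⟨
      (X *ᴹ (Y *ᴹ Z)) a b
        ∎

    *ᴹ-zeroˡ : (X : Mat N (Poly m)) → 0ᴹ *ᴹ X ≋ᴹ 0ᴹ
    *ᴹ-zeroˡ X a b = ≋-trans (*ᴹ-entry 0ᴹ X a b) (sum-replicate-zero N)

    *ᴹ-zeroʳ : (X : Mat N (Poly m)) → X *ᴹ 0ᴹ ≋ᴹ 0ᴹ
    *ᴹ-zeroʳ X a b = begin
      (X *ᴹ 0ᴹ) a b                 ≈⟨ *ᴹ-entry X 0ᴹ a b ⟩
      ∑[ k < N ] (X a k *ₚ 0ₚ)      ≈⟨ sum-cong-≋ (λ k → *ₚ-zeroʳ (X a k)) ⟩
      ∑[ k < N ] 0ₚ                 ≈⟨ sum-replicate-zero N ⟩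
      0ₚ                            ∎

    *ᴹ-distribˡ : (X Y Z : Mat N (Poly m)) → X *ᴹ (Y +ᴹ Z) ≋ᴹ (X *ᴹ Y) +ᴹ (X *ᴹ Z)
    *ᴹ-distribˡ X Y Z a b = begin
      (X *ᴹ (Y +ᴹ Z)) a b
        ≈⟨ *ᴹ-entry X (Y +ᴹ Z) a b ⟩
      ∑[ k < N ] (X a k *ₚ (Y k b +ₚ Z k b))
        ≈⟨ sum-cong-≋ (λ k → *ₚ-distribˡ (X a k) (Y k b) (Z k b)) ⟩
      ∑[ k < N ] ((X a k *ₚ Y k b) +ₚ (X a k *ₚ Z k b))
        ≈⟨ ∑-distrib-+ (λ k → X a k *ₚ Y k b) (λ k → X a k *ₚ Z k b) ⟩
      (∑[ k < N ] (X a k *ₚ Y k b)) +ₚ (∑[ k < N ] (X a k *ₚ Z k b))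
        ≈⟨ +ₚ-cong (*ᴹ-entry X Y a b) (*ᴹ-entry X Z a b) ⟨
      ((X *ᴹ Y) +ᴹ (X *ᴹ Z)) a b
        ∎

    *ᴹ-distribʳ : (X Y Z : Mat N (Poly m)) → (Y +ᴹ Z) *ᴹ X ≋ᴹ (Y *ᴹ X) +ᴹ (Z *ᴹ X)
    *ᴹ-distribʳ X Y Z a b = begin
      ((Y +ᴹ Z) *ᴹ X) a b
        ≈⟨ *ᴹ-entry (Y +ᴹ Z) X a b ⟩
      ∑[ k < N ] ((Y a k +ₚ Z a k) *ₚ X k b)
        ≈⟨ sum-cong-≋ (λ k → *ₚ-distribʳ (X k b) (Y a k) (Z a k)) ⟩
      ∑[ k < N ] ((Y a k *ₚ X k b) +ₚ (Z a k *ₚ X k b))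
        ≈⟨ ∑-distrib-+ (λ k → Y a k *ₚ X k b) (λ k → Z a k *ₚ X k b) ⟩
      (∑[ k < N ] (Y a k *ₚ X k b)) +ₚ (∑[ k < N ] (Z a k *ₚ X k b))
        ≈⟨ +ₚ-cong (*ᴹ-entry Y X a b) (*ᴹ-entry Z X a b) ⟨
      ((Y *ᴹ X) +ᴹ (Z *ᴹ X)) a b
        ∎

    •ᴹ-*ᴹ : ∀ s (X Y : Mat N (Poly m)) → (s •ᴹ X) *ᴹ Y ≋ᴹ s •ᴹ (X *ᴹ Y)
    •ᴹ-*ᴹ s X Y a b = begin
      ((s •ᴹ X) *ᴹ Y) a b                    ≈⟨ *ᴹ-entry (s •ᴹ X) Y a b ⟩
      ∑[ k < N ] ((s •ₚ X a k) *ₚ Y k b)     ≈⟨ sum-cong-≋ (λ k → •ₚ-*ₚ s (X a k) (Y k b)) ⟩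
      ∑[ k < N ] (s •ₚ (X a k *ₚ Y k b))     ≡⟨ •ₚ-distrib-sum s (λ k → X a k *ₚ Y k b) ⟨
      s •ₚ (∑[ k < N ] (X a k *ₚ Y k b))     ≈⟨ •ₚ-cong s (*ᴹ-entry X Y a b) ⟨
      (s •ᴹ (X *ᴹ Y)) a b                    ∎

    *ᴹ-•ᴹ : ∀ s (X Y : Mat N (Poly m)) → X *ᴹ (s •ᴹ Y) ≋ᴹ s •ᴹ (X *ᴹ Y)
    *ᴹ-•ᴹ s X Y a b = begin
      (X *ᴹ (s •ᴹ Y)) a b                    ≈⟨ *ᴹ-entry X (s •ᴹ Y) a b ⟩
      ∑[ k < N ] (X a k *ₚ (s •ₚ Y k b))     ≈⟨ sum-cong-≋ (λ k → *ₚ-•ₚ s (X a k) (Y k b)) ⟩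
      ∑[ k < N ] (s •ₚ (X a k *ₚ Y k b))     ≡⟨ •ₚ-distrib-sum s (λ k → X a k *ₚ Y k b) ⟨
      s •ₚ (∑[ k < N ] (X a k *ₚ Y k b))     ≈⟨ •ₚ-cong s (*ᴹ-entry X Y a b) ⟨
      (s •ᴹ (X *ᴹ Y)) a b                    ∎

  *ᴹ-identityˡ : ∀ {m N} (X : Mat N (Poly m)) → 1ᴹ *ᴹ X ≋ᴹ X
  *ᴹ-identityˡ {N = suc n} X a b = begin
    (1ᴹ *ᴹ X) a b                                        ≈⟨ *ᴹ-entry 1ᴹ X a b ⟩
    ∑[ k < suc n ] (1ᴹ a k *ₚ X k b)                     ≈⟨ sum-remove (λ k → 1ᴹ a k *ₚ X k b) ⟩
    (1ᴹ a a *ₚ X a b) +ₚ (∑[ k < n ] (1ᴹ a (punchIn a k) *ₚ X (punchIn a k) b))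
      ≈⟨ +ₚ-cong diagonal offDiagonal ⟩
    X a b +ₚ 0ₚ                                          ≡⟨ ++-identityʳ (X a b) ⟩
    X a b                                                ∎
    where
      diagonal : 1ᴹ a a *ₚ X a b ≋ X a b
      diagonal = ≋-trans (≋-reflexive (≡.cong (_*ₚ X a b) (1ᴹ-diag a))) (*ₚ-identityˡ (X a b))
      offDiagonal : ∑[ k < n ] (1ᴹ a (punchIn a k) *ₚ X (punchIn a k) b) ≋ 0ₚ
      offDiagonal = ≋-trans
        (sum-cong-≋ (λ k → ≋-reflexive (≡.cong (_*ₚ X (punchIn a k) b)
                                            (1ᴹ-offDiag (λ e → punchInᵢ≢i a k (≡.sym e))))))
        (sum-replicate-zero n)

module Evaluation {c ℓ} (F : Field c ℓ) where
  open NCPoly F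
  open PolynomialSemiring F
  open MatrixAlgebra F
  open CommutativeRing (Field.commutativeRing F)
    using (_≈_; 1#; 0#; +-cong; +-identityʳ; *-identityˡ)
    renaming (_*_ to _·_; _+_ to _⊕_; refl to ≈-refl; sym to ≈-sym; trans to ≈-trans)

  module _ {n m N} (C : Fin n → Mat N (Poly m)) where
    open ≋-Reasoning

    eval-+ₚ : (p q : Poly n) → ∀ a b → eval (p +ₚ q) C a b ≡ (eval p C +ᴹ eval q C) a b
    eval-+ₚ []            q a b = ≡.refl
    eval-+ₚ ((s , w) ∷ p) q a b =
      ≡.trans (≡.cong ((s •ₚ evalMon w C a b) ++_) (eval-+ₚ p q a b))
              (≡.sym (++-assoc (s •ₚ evalMon w C a b) (eval p C a b) (eval q C a b)))

    eval-sumFin : ∀ K (g : Fin K → Poly n) a b →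
                  eval (sumFin K g) C a b ≡ sumFin K (λ k → eval (g k) C a b)
    eval-sumFin zero    g a b = ≡.refl
    eval-sumFin (suc K) g a b = ≡.trans (eval-+ₚ (g zero) (sumFin K (λ k → g (suc k))) a b)
      (≡.cong (eval (g zero) C a b ++_) (eval-sumFin K (λ k → g (suc k)) a b))

    eval-•ₚ : ∀ s (p : Poly n) → eval (s •ₚ p) C ≋ᴹ s •ᴹ eval p C
    eval-•ₚ s []            a b = ≋-refl
    eval-•ₚ s ((t , w) ∷ p) a b =
      ≋-trans (+ₚ-cong (•ₚ-assoc s t (evalMon w C a b)) (eval-•ₚ s p a b))
              (≋-reflexive (≡.sym (•ₚ-distrib-+ₚ s (t •ₚ evalMon w C a b) (eval p C a b))))

    eval-1ₚ : eval 1ₚ C ≋ᴹ 1ᴹ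
    eval-1ₚ a b = ≋-trans (≋-reflexive (++-identityʳ _)) (•ₚ-identityˡ (1ᴹ a b))

    evalMon-++ : (u v : Word n) → evalMon (u ++ v) C ≋ᴹ evalMon u C *ᴹ evalMon v C
    evalMon-++ []      v a b = ≋-sym (*ᴹ-identityˡ (evalMon v C) a b)
    evalMon-++ (j ∷ u) v a b =
      ≋-trans (*ᴹ-cong {X = C j} {X′ = C j} (λ _ _ → ≋-refl) (evalMon-++ u v) a b)
              (≋-sym (*ᴹ-assoc (C j) (evalMon u C) (evalMon v C) a b))

    eval-*ₚ : (p q : Poly n) → eval (p *ₚ q) C ≋ᴹ eval p C *ᴹ eval q C
    eval-*ₚ []            q a b = ≋-sym (*ᴹ-zeroˡ (eval q C) a b)
    eval-*ₚ ((s , u) ∷ p) q a b = begin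
      eval (map ((s , u) *ₜ_) q ++ p *ₚ q) C a b
        ≡⟨ eval-+ₚ (map ((s , u) *ₜ_) q) (p *ₚ q) a b ⟩
      eval (map ((s , u) *ₜ_) q) C a b +ₚ eval (p *ₚ q) C a b
        ≈⟨ +ₚ-cong (eval-*ₜ q a b) (eval-*ₚ p q a b) ⟩
      ((s •ᴹ Mᵤ) *ᴹ eval q C) a b +ₚ (eval p C *ᴹ eval q C) a b
        ≈⟨ *ᴹ-distribʳ (eval q C) (s •ᴹ Mᵤ) (eval p C) a b ⟨
      (((s •ᴹ Mᵤ) +ᴹ eval p C) *ᴹ eval q C) a b
        ∎
      where
        Mᵤ = evalMon u C

        eval-*ₜ : ∀ q → eval (map ((s , u) *ₜ_) q) C ≋ᴹ (s •ᴹ Mᵤ) *ᴹ eval q C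
        eval-*ₜ []            a b = ≋-sym (*ᴹ-zeroʳ (s •ᴹ Mᵤ) a b)
        eval-*ₜ ((t , v) ∷ q) a b = begin
          ((s · t) •ₚ evalMon (u ++ v) C a b) +ₚ eval (map ((s , u) *ₜ_) q) C a b
            ≈⟨ +ₚ-cong (•ₚ-evalMon-++ a b) (eval-*ₜ q a b) ⟩
          ((s •ᴹ Mᵤ) *ᴹ (t •ᴹ Mᵥ)) a b +ₚ ((s •ᴹ Mᵤ) *ᴹ eval q C) a b
            ≈⟨ *ᴹ-distribˡ (s •ᴹ Mᵤ) (t •ᴹ Mᵥ) (eval q C) a b ⟨
          ((s •ᴹ Mᵤ) *ᴹ ((t •ᴹ Mᵥ) +ᴹ eval q C)) a b
            ∎
          where
            Mᵥ = evalMon v C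

            •ₚ-evalMon-++ : (s · t) •ᴹ evalMon (u ++ v) C ≋ᴹ (s •ᴹ Mᵤ) *ᴹ (t •ᴹ Mᵥ)
            •ₚ-evalMon-++ a b = begin
              (s · t) •ₚ evalMon (u ++ v) C a b   ≈⟨ •ₚ-cong (s · t) (evalMon-++ u v a b) ⟩
              (s · t) •ₚ (Mᵤ *ᴹ Mᵥ) a b           ≈⟨ •ₚ-assoc s t ((Mᵤ *ᴹ Mᵥ) a b) ⟩
              s •ₚ (t •ₚ (Mᵤ *ᴹ Mᵥ) a b)          ≈⟨ •ₚ-cong s (*ᴹ-•ᴹ t Mᵤ Mᵥ a b) ⟨
              s •ₚ (Mᵤ *ᴹ (t •ᴹ Mᵥ)) a b          ≈⟨ •ᴹ-*ᴹ s Mᵤ (t •ᴹ Mᵥ) a b ⟨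
              ((s •ᴹ Mᵤ) *ᴹ (t •ᴹ Mᵥ)) a b        ∎

    linExt-eval : ∀ L (p : Poly n) a b →
                  linExt L (eval p C a b) ≈ linExt (λ w → linExt L (evalMon w C a b)) p
    linExt-eval L []            a b = ≈-refl
    linExt-eval L ((s , w) ∷ p) a b =
      ≈-trans (linExt-++ L (s •ₚ evalMon w C a b) (eval p C a b))
              (+-cong (linExt-• L s (evalMon w C a b)) (linExt-eval L p a b))

    eval-cong : {p q : Poly n} → p ≋ q → eval p C ≋ᴹ eval q C
    eval-cong {p} {q} p≋q a b = by-linExt λ L →
      ≈-trans (linExt-eval L p a b)
              (≈-trans (linExt-≈ p≋q _) (≈-sym (linExt-eval L q a b)))

  vars : ∀ {n} → Fin n → Mat 1 (Poly n)
  vars j _ _ = var j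

  module _ {n : ℕ} where
    open Relation.Binary.Reasoning.Setoid (CommutativeRing.setoid (Field.commutativeRing F))

    linExt-evalMon-vars : ∀ L (w : Word n) → linExt L (evalMon w vars zero zero) ≈ L w
    linExt-evalMon-vars L []      = ≈-trans (+-identityʳ _) (*-identityˡ _)
    linExt-evalMon-vars L (j ∷ w) = begin
      linExt L ((var j *ₚ M) ++ [])          ≡⟨ ≡.cong (linExt L) (++-identityʳ (var j *ₚ M)) ⟩
      linExt L (var j *ₚ M)                  ≈⟨ linExt-*ₚ L (var j) M ⟩
      1# · linExt (λ v → L (j ∷ v)) M ⊕ 0#   ≈⟨ +-identityʳ _ ⟩
      1# · linExt (λ v → L (j ∷ v)) M        ≈⟨ *-identityˡ _ ⟩
      linExt (λ v → L (j ∷ v)) M             ≈⟨ linExt-evalMon-vars (λ v → L (j ∷ v)) w ⟩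
      L (j ∷ w)                              ∎
      where
        M = evalMon w vars zero zero

    eval-vars : (f : Poly n) → eval f vars zero zero ≋ f
    eval-vars f = by-linExt λ L →
      ≈-trans (linExt-eval vars L f zero zero) (linExt-cong f (linExt-evalMon-vars L))

firstIdx-combine : ∀ {P Q} (pP : 0 < P) (pQ : 0 < Q) (pPQ : 0 < P * Q) →
                   firstIdx pPQ ≡ combine (firstIdx pP) (firstIdx pQ)
firstIdx-combine (s≤s z≤n) (s≤s z≤n) _ = ≡.refl

toℕ-lastIdx : ∀ {N} (p : 0 < suc N) → toℕ (lastIdx p) ≡ N
toℕ-lastIdx {N} _ = toℕ-fromℕ< (ℕ.n<1+n N)

lastIdx-combine : ∀ {P Q} (pP : 0 < P) (pQ : 0 < Q) (pPQ : 0 < P * Q) →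
                  lastIdx pPQ ≡ combine (lastIdx pP) (lastIdx pQ)
lastIdx-combine {suc P} {suc Q} pP pQ pPQ = toℕ-injective (begin
  toℕ (lastIdx pPQ)                                  ≡⟨ toℕ-lastIdx pPQ ⟩
  Q + P * suc Q                                      ≡⟨ ℕ.+-comm Q (P * suc Q) ⟩
  P * suc Q + Q                                      ≡⟨ ≡.cong (_+ Q) (ℕ.*-comm P (suc Q)) ⟩
  suc Q * P + Q                                      ≡⟨ ≡.cong₂ (λ i j → suc Q * i + j)
                                                            (toℕ-lastIdx pP) (toℕ-lastIdx pQ) ⟨
  suc Q * toℕ (lastIdx pP) + toℕ (lastIdx pQ)        ≡⟨ toℕ-combine (lastIdx pP) (lastIdx pQ) ⟨
  toℕ (combine (lastIdx pP) (lastIdx pQ))            ∎)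
  where open ≡.≡-Reasoning

module BlockSubstitution {c ℓ} (F : Field c ℓ) where
  open NCPoly F
  open PolynomialSemiring F
  open MatrixAlgebra F
  open Evaluation F
  open ≋-Reasoning

  substEntries : ∀ {m m′ P Q} → Mat P (Poly m) → (Fin m → Mat Q (Poly m′)) →
                 Mat (P * Q) (Poly m′)
  substEntries {P = P} {Q} M A i i′ =
    eval (M (quotient Q i) (quotient Q i′)) A (remainder {P} Q i) (remainder {P} Q i′)

  substEntries-combine : ∀ {m m′ P Q} (M : Mat P (Poly m)) (A : Fin m → Mat Q (Poly m′)) a x b y →
                         substEntries M A (combine a x) (combine b y) ≡ eval (M a b) A x y
  substEntries-combine M A a x b y =
    ≡.cong₂ (λ (u v : Fin _ × Fin _) → eval (M (proj₁ u) (proj₁ v)) A (proj₂ u) (proj₂ v))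
            (remQuot-combine a x) (remQuot-combine b y)

  sumFin-↑ : ∀ {m} P Q (h : Fin (P + Q) → Poly m) →
             sumFin (P + Q) h ≡ sumFin P (λ i → h (i ↑ˡ Q)) +ₚ sumFin Q (λ j → h (P ↑ʳ j))
  sumFin-↑ zero    Q h = ≡.refl
  sumFin-↑ (suc P) Q h = ≡.trans (≡.cong (h zero ++_) (sumFin-↑ P Q (λ i → h (suc i))))
    (≡.sym (++-assoc (h zero) (sumFin P (λ i → h (suc (i ↑ˡ Q))))
                              (sumFin Q (λ j → h (suc (P ↑ʳ j))))))

  sumFin-combine : ∀ {m} P Q (h : Fin (P * Q) → Poly m) →
                   sumFin (P * Q) h ≡ sumFin P (λ k → sumFin Q (λ z → h (combine k z)))
  sumFin-combine zero    Q h = ≡.refl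
  sumFin-combine (suc P) Q h = ≡.trans (sumFin-↑ Q (P * Q) h)
    (≡.cong (sumFin Q (λ z → h (z ↑ˡ P * Q)) ++_) (sumFin-combine P Q (λ i → h (Q ↑ʳ i))))

  1ᴹ-combine : ∀ {m m′ P Q} (A : Fin m → Mat Q (Poly m′)) (a b : Fin P) (x y : Fin Q) →
               1ᴹ (combine a x) (combine b y) ≋ eval (1ᴹ a b) A x y
  1ᴹ-combine A a b x y with a ≟ᶠ b
  ... | no a≢b  = ≋-reflexive (1ᴹ-offDiag (a≢b ∘ combine-injectiveˡ a x b y))
  ... | yes ≡.refl = ≋-trans (≋-reflexive (1ᴹ-sameBlock a x y)) (≋-sym (eval-1ₚ A x y))
    where
      1ᴹ-sameBlock : ∀ {m P Q} (a : Fin P) (x y : Fin Q) →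
                     1ᴹ {m} (combine a x) (combine a y) ≡ 1ᴹ x y
      1ᴹ-sameBlock a x y with x ≟ᶠ y
      ... | yes ≡.refl = 1ᴹ-diag (combine a x)
      ... | no  x≢y    = 1ᴹ-offDiag (x≢y ∘ combine-injectiveʳ a x a y)

  module _ {n m m′ P Q} (C : Fin n → Mat P (Poly m)) (A : Fin m → Mat Q (Poly m′)) where

    evalMon-substEntries : ∀ w a b x y →
      evalMon w (λ j → substEntries (C j) A) (combine a x) (combine b y) ≋ eval (evalMon w C a b) A x y
    evalMon-substEntries []      a b x y = 1ᴹ-combine A a b x y
    evalMon-substEntries (j ∷ w) a b x y = begin
      sumFin (P * Q) (λ i → B j (combine a x) i *ₚ evalMon w B i (combine b y))
        ≡⟨ sumFin-combine P Q _ ⟩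
      sumFin P (λ k → sumFin Q (λ z →
        B j (combine a x) (combine k z) *ₚ evalMon w B (combine k z) (combine b y)))
        ≈⟨ sumFin-cong P (λ k → sumFin-cong Q (λ z →
             *ₚ-cong (≋-reflexive (substEntries-combine (C j) A a x k z))
                     (evalMon-substEntries w k b z y))) ⟩
      sumFin P (λ k → (eval (C j a k) A *ᴹ eval (evalMon w C k b) A) x y)
        ≈⟨ sumFin-cong P (λ k → eval-*ₚ A (C j a k) (evalMon w C k b) x y) ⟨
      sumFin P (λ k → eval (C j a k *ₚ evalMon w C k b) A x y)
        ≡⟨ eval-sumFin A P (λ k → C j a k *ₚ evalMon w C k b) x y ⟨
      eval (sumFin P (λ k → C j a k *ₚ evalMon w C k b)) A x y
        ∎
      where
        B = λ j → substEntries (C j) A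

    eval-substEntries : ∀ (g : Poly n) a b x y →
      eval g (λ j → substEntries (C j) A) (combine a x) (combine b y) ≋ eval (eval g C a b) A x y
    eval-substEntries []            a b x y = ≋-refl
    eval-substEntries ((s , w) ∷ g) a b x y = begin
      (s •ₚ evalMon w B (combine a x) (combine b y)) +ₚ eval g B (combine a x) (combine b y)
        ≈⟨ +ₚ-cong (•ₚ-cong s (evalMon-substEntries w a b x y)) (eval-substEntries g a b x y) ⟩
      (s •ₚ eval (evalMon w C a b) A x y) +ₚ eval (eval g C a b) A x y
        ≈⟨ +ₚ-cong (eval-•ₚ A s (evalMon w C a b) x y) (≋-refl {x = eval (eval g C a b) A x y}) ⟨
      eval (s •ₚ evalMon w C a b) A x y +ₚ eval (eval g C a b) A x y
        ≡⟨ eval-+ₚ A (s •ₚ evalMon w C a b) (eval g C a b) x y ⟨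
      eval ((s •ₚ evalMon w C a b) +ₚ eval g C a b) A x y
        ∎
      where
        B = λ j → substEntries (C j) A

  corner-combine : ∀ {a} {X : Set a} {P Q} (pP : 0 < P) (pQ : 0 < Q) (pPQ : 0 < P * Q)
                   (M : Mat (P * Q) X) →
                   corner pPQ M ≡ M (combine (firstIdx pP) (firstIdx pQ))
                                    (combine (lastIdx pP) (lastIdx pQ))
  corner-combine pP pQ pPQ M = ≡.cong₂ M (firstIdx-combine pP pQ pPQ) (lastIdx-combine pP pQ pPQ)

module IteratedSubstitution {c ℓ} (F : Field c ℓ) where
  open NCPoly F
  open PolynomialSemiring F
  open Evaluation F
  open BlockSubstitution F
  open ≋-Reasoning

  module Collapse (K : ℕ) (nv d : ℕ → ℕ) (dpos : ∀ i → i < K → 0 < d i)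
                  (Acoef : (i : ℕ) → Fin (nv i) → Fin (nv (suc i)) → Mat (d i) Scalar)
                  (f : Poly (nv 0)) where
    open Tower K nv d dpos Acoef f

    composite : ∀ i → Fin (nv 0) → Mat (prodUpTo d i) (Poly (nv i))
    composite zero      = vars
    composite (suc i) j = substEntries (composite i j) (Amat i)

    -- Stated for every positivity witness, so that witnesses never need comparing.
    fs≋corner-composite : ∀ i (i≤K : i ≤ K) (pos : 0 < prodUpTo d i) →
                          fs i i≤K ≋ corner pos (eval f (composite i))
    fs≋corner-composite zero    _   _   = ≋-sym (eval-vars f)
    fs≋corner-composite (suc i) i<K pos = begin
      corner dᵢ-pos (eval (fs i (ℕ.<⇒≤ i<K)) (Amat i))
        ≈⟨ eval-cong (Amat i) (fs≋corner-composite i (ℕ.<⇒≤ i<K) pos′)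
                     (firstIdx dᵢ-pos) (lastIdx dᵢ-pos) ⟩
      corner dᵢ-pos (eval (corner pos′ (eval f (composite i))) (Amat i))
        ≈⟨ eval-substEntries (composite i) (Amat i) f _ _ _ _ ⟨
      eval f (composite (suc i)) (combine (firstIdx pos′) (firstIdx dᵢ-pos))
                                 (combine (lastIdx pos′) (lastIdx dᵢ-pos))
        ≡⟨ corner-combine pos′ dᵢ-pos pos (eval f (composite (suc i))) ⟨
      corner pos (eval f (composite (suc i)))
        ∎
      where
        dᵢ-pos = dpos i i<K
        pos′   = prodUpTo-pos d i (λ j j<i → dpos j (ℕ.<-trans j<i i<K))

mainTheorem3 : ∀ {c ℓ} (F : Field c ℓ) → let open NCPoly F in
    (K : ℕ) (nv : ℕ → ℕ) (d : ℕ → ℕ)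
    (dpos : ∀ i → i < K → 0 < d i)
    (Acoef : (i : ℕ) → Fin (nv i) → Fin (nv (suc i)) → Mat (d i) Scalar)
    (f : Poly (nv 0)) (D : ℕ) →
    NonZero f → HasDegree f D →
    Σ (Fin (nv 0) → Mat (prodUpTo d K) (Poly (nv K))) λ C →
      Tower.fs K nv d dpos Acoef f K ≤-refl
        ≈ₚ corner (prodUpTo-pos d K dpos) (eval f C)
mainTheorem3 F K nv d dpos Acoef f _ _ _ =
  composite K , ≋⇒≈ₚ (fs≋corner-composite K ≤-refl (prodUpTo-pos d K dpos))
  where
    open PolynomialSemiring F using (≋⇒≈ₚ)
    open IteratedSubstitution.Collapse F K nv d dpos Acoef f
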